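{- Let $G\in\mathcal{F}_{\circ}^2(4)$ and let $ab$ be a contractible inner edge of $G$. Let $x,y$ be vertices such that $abx$ and $aby$ are faces of $G$ and $x$ is a boundary vertex with $\deg(x)=4$. Then $ab$ is a triode detecting edge whenever $y$ is a boundary vertex with $\deg(y)\ge4$ or $y$ is an inner vertex with $\deg(y)\ge5$.
   Context: A triangulation of a compact connected surface $F^2$ is a simple graph $G$ embedded in $F^2$ with every face bounded by a 3-cycle and any two faces sharing at most one edge; $\partial G$ triangulates $\partial F^2$ (boundary vertices/edges; others inner; an inner edge may have both ends on $\partial G$). Contracting $e=uv$ identifies $u,v$ and deletes multiple edges; $e$ is contractible if $G/e$ is a triangulation of $F^2$. $\mathcal{F}_{\circ}^2(4)$ is the class of triangulations of $F^2$ with all degrees $\ge3$ and all inner vertices of degree $\ge4$. A triode is a boundary vertex of degree $3$; a contractible edge is a triode detecting edge if all vertices of degree $3$ produced by its contraction are triodes. -}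

module Defs where

open import Data.Nat using (ℕ; _≤_; _+_; _*_)
open import Data.Nat.DivMod using (_/_)
open import Data.Nat.ListAction using (sum)
open import Data.Integer as ℤ using (ℤ; +_)
open import Data.Fin using (Fin)
open import Data.Fin.Properties using (_≟_; any?)
open import Data.List using (List; []; _∷_; map; filter; length; allFin)
open import Data.List.Relation.Unary.Any using (Any)
import Data.List.Relation.Unary.Any as Any
open import Data.List.Relation.Unary.AllPairs using (AllPairs)
open import Data.List.Relation.Unary.All using (All)
open import Data.List.Relation.Binary.Pointwise using (Pointwise)
open import Data.Product using (Σ; ∃; _×_; _,_; proj₁)
open import Data.Sum using (_⊎_)
open import Relation.Binary.PropositionalEquality using (_≡_; _≢_)
open import Relation.Binary.Construct.Closure.ReflexiveTransitive using (Star)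
open import Relation.Nullary using (¬_; Dec; yes; no)
open import Relation.Nullary.Decidable using (_×-dec_; _⊎-dec_; ¬?)
open import Relation.Unary using (Decidable)

-- The graph G is the 1-skeleton: vertices = those
-- lying on some face, edges = pairs lying on a common face.

Tri : ℕ → Set
Tri n = Fin n × Fin n × Fin n

Cx : ℕ → Set
Cx n = List (Tri n)

_∈ᵗ_ : ∀ {n} → Fin n → Tri n → Set
v ∈ᵗ (p , q , r) = v ≡ p ⊎ v ≡ q ⊎ v ≡ r

_∈ᵗ?_ : ∀ {n} (v : Fin n) (t : Tri n) → Dec (v ∈ᵗ t)
v ∈ᵗ? (p , q , r) = (v ≟ p) ⊎-dec ((v ≟ q) ⊎-dec (v ≟ r))

Proper : ∀ {n} → Tri n → Set
Proper (p , q , r) = p ≢ q × q ≢ r × p ≢ r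

-- two proper triangles span the same vertex set
SameSet : ∀ {n} → Tri n → Tri n → Set
SameSet (p , q , r) t = p ∈ᵗ t × q ∈ᵗ t × r ∈ᵗ t

IsFace : ∀ {n} → Cx n → Fin n → Fin n → Fin n → Set
IsFace K u v w = (u ≢ v × v ≢ w × u ≢ w) × Any (λ t → u ∈ᵗ t × v ∈ᵗ t × w ∈ᵗ t) K

isFace? : ∀ {n} (K : Cx n) (u v w : Fin n) → Dec (IsFace K u v w)
isFace? K u v w =
  (¬? (u ≟ v) ×-dec (¬? (v ≟ w) ×-dec ¬? (u ≟ w)))
  ×-dec Any.any? (λ t → (u ∈ᵗ? t) ×-dec ((v ∈ᵗ? t) ×-dec (w ∈ᵗ? t))) K

Vertex : ∀ {n} → Cx n → Fin n → Set
Vertex K v = Any (v ∈ᵗ_) K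

vertex? : ∀ {n} (K : Cx n) → Decidable (Vertex K)
vertex? K v = Any.any? (v ∈ᵗ?_) K

Edge : ∀ {n} → Cx n → Fin n → Fin n → Set
Edge K u v = u ≢ v × ∃ (λ w → IsFace K u v w)

edge? : ∀ {n} (K : Cx n) (u v : Fin n) → Dec (Edge K u v)
edge? K u v = ¬? (u ≟ v) ×-dec any? (λ w → isFace? K u v w)

count : ∀ {n} {P : Fin n → Set} → Decidable P → ℕ
count {n} P? = length (filter P? (allFin n))

deg : ∀ {n} → Cx n → Fin n → ℕ
deg K v = count (edge? K v)

nFaces : ∀ {n} → Cx n → Fin n → Fin n → ℕ
nFaces K u v = count (isFace? K u v)

BoundaryEdge : ∀ {n} → Cx n → Fin n → Fin n → Set
BoundaryEdge K u v = Edge K u v × nFaces K u v ≡ 1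

InnerEdge : ∀ {n} → Cx n → Fin n → Fin n → Set
InnerEdge K u v = Edge K u v × ¬ (nFaces K u v ≡ 1)

BoundaryVertex : ∀ {n} → Cx n → Fin n → Set
BoundaryVertex K v = ∃ (λ u → BoundaryEdge K v u)

InnerVertex : ∀ {n} → Cx n → Fin n → Set
InnerVertex K v = Vertex K v × ¬ BoundaryVertex K v

-- K triangulates a compact connected surface (possibly with boundary):
--  * faces are proper triangles, no face listed twice (so G is simple and
--    two faces share at most one edge);
--  * the link of every vertex is a path or a cycle: it is connected and
--    every link vertex has link-degree 1 or 2;
--  * K is nonempty and G is connected.

Triangulation : ∀ {n} → Cx n → Set
Triangulation {n} K =
    All Proper K
  × AllPairs (λ s t → ¬ SameSet s t) K
  × (∀ v u → Edge K v u → nFaces K v u ≡ 1 ⊎ nFaces K v u ≡ 2)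
  × (∀ v u u′ → Edge K v u → Edge K v u′ → Star (IsFace K v) u u′)
  × ∃ (λ v → Vertex K v)
  × (∀ u v → Vertex K u → Vertex K v → Star (Edge K) u v)

-- Topological invariants determining the surface (classification of
-- compact surfaces): Euler characteristic, orientability, number of
-- boundary components.

nV : ∀ {n} → Cx n → ℕ
nV K = count (vertex? K)

nE : ∀ {n} → Cx n → ℕ
nE K = (sum (map (λ u → count (edge? K u)) (allFin _))) / 2

nF : ∀ {n} → Cx n → ℕ
nF K = (sum (map (λ u → sum (map (λ v → count (isFace? K u v)) (allFin _))) (allFin _))) / 6

euler : ∀ {n} → Cx n → ℤ
euler K = (+ nV K ℤ.- + nE K) ℤ.+ + nF K

DirIn : ∀ {n} → Fin n → Fin n → Tri n → Set
DirIn u v (p , q , r) = (u ≡ p × v ≡ q) ⊎ (u ≡ q × v ≡ r) ⊎ (u ≡ r × v ≡ p)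

-- a coherent orientation: an ordering of every face so that no directed
-- edge is traversed by two faces
Orientable : ∀ {n} → Cx n → Set
Orientable {n} K = Σ (List (Tri n)) λ σ →
    Pointwise SameSet K σ
  × AllPairs (λ s t → ∀ u v → DirIn u v s → ¬ DirIn u v t) σ

-- the boundary graph ∂G has exactly k connected components
BoundaryComponents : ∀ {n} → Cx n → ℕ → Set
BoundaryComponents {n} K k = Σ (Fin n → Fin k) λ f →
    (∀ u v → BoundaryVertex K u → BoundaryVertex K v →
       (f u ≡ f v → Star (BoundaryEdge K) u v) × (Star (BoundaryEdge K) u v → f u ≡ f v))
  × (∀ i → ∃ (λ u → BoundaryVertex K u × f u ≡ i))

SameSurface : ∀ {n} → Cx n → Cx n → Set
SameSurface K L =
    euler K ≡ euler L
  × (Orientable K → Orientable L) × (Orientable L → Orientable K)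
  × ∃ (λ k → BoundaryComponents K k × BoundaryComponents L k)

-- Edge contraction G/ab: b is identified with a, the faces containing
-- both a and b disappear (multiple edges are merged automatically).

rename : ∀ {n} → Fin n → Fin n → Fin n → Fin n
rename a b c with c ≟ b
... | yes _ = a
... | no  _ = c

contract : ∀ {n} → Cx n → Fin n → Fin n → Cx n
contract K a b =
  map (λ { (p , q , r) → (rename a b p , rename a b q , rename a b r) })
      (filter (λ t → ¬? ((a ∈ᵗ? t) ×-dec (b ∈ᵗ? t))) K)

Contractible : ∀ {n} → Cx n → Fin n → Fin n → Set
Contractible K a b =
  Edge K a b × Triangulation (contract K a b) × SameSurface K (contract K a b)

F4 : ∀ {n} → Cx n → Set
F4 K = Triangulation K
     × (∀ v → Vertex K v → 3 ≤ deg K v)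
     × (∀ v → InnerVertex K v → 4 ≤ deg K v)

Triode : ∀ {n} → Cx n → Fin n → Set
Triode K v = BoundaryVertex K v × deg K v ≡ 3

-- every degree-3 vertex produced by the contraction (the merged vertex a,
-- or a vertex whose degree became 3) is a triode of G/ab
TriodeDetecting : ∀ {n} → Cx n → Fin n → Fin n → Set
TriodeDetecting K a b =
  Contractible K a b ×
  (∀ v → Vertex (contract K a b) v → deg (contract K a b) v ≡ 3 →
     (v ≡ a ⊎ ¬ (deg K v ≡ 3)) → Triode (contract K a b) v)

-- Contracting ab removes b and the two faces abx, aby, merges every edge ub into ua and keeps the rest.
-- Counting vertices, edges (through the degree sum) and faces (through the sum of edge-face incidences)
-- shows that the Euler characteristic changes by c − 2, where c is the number of common neighbours of a
-- and b; as G/ab triangulates the same surface, c = 2, so x and y are the only common neighbours.  Hence a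
-- vertex v ∉ {a, b} loses an edge exactly when v ∈ {x, y}, and the merged vertex has degree
-- deg a + deg b − 4.  If that is 3, one of a, b has degree 3 and so lies on the boundary; a vertex that
-- newly has degree 3 is x or y with degree 4, hence a boundary vertex (y because inner vertices of degree 4
-- are excluded).  Finally boundary vertices stay on the boundary: a boundary edge ua or ub yields the
-- boundary edge ua of G/ab, since the link of a vertex is connected.

module Submission where

open import Defs
open import Data.Bool.Base using (true; false; if_then_else_)
open import Data.Empty using (⊥; ⊥-elim)
open import Data.Fin.Base using (Fin; zero; suc)
open import Data.Fin.Properties using (_≟_; any?)
import Data.Integer.Base as ℤ
import Data.Integer.Properties as ℤ
import Data.Integer.Tactic.RingSolver as ℤ-Solver
open import Data.List.Base using (List; []; _∷_; filter; length; tabulate; map; allFin)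
open import Data.List.Membership.Propositional using (_∈_; _∉_; find; lose)
open import Data.List.Membership.Propositional.Properties using (∈-filter⁺; ∈-map∘filter⁻; ∈-map∘filter⁺)
open import Data.List.Relation.Unary.All using (All; []; _∷_; lookup)
import Data.List.Relation.Unary.All.Properties as All
open import Data.List.Relation.Unary.AllPairs using (AllPairs; []; _∷_)
import Data.List.Relation.Unary.AllPairs.Properties as AllPairs
open import Data.List.Relation.Unary.Any using (Any; here; there)
import Data.List.Relation.Unary.Any as Any
open import Data.List.Relation.Unary.Any.Properties using (Any-⊎⁻)
open import Data.List.Relation.Unary.Unique.Propositional using (Unique)
open import Data.Nat.Base using (ℕ; zero; suc; _≤_; _<_; _+_; _*_; z≤n; s≤s)
open import Data.Nat.DivMod using (_/_; +-distrib-/-∣ʳ; m*n/n≡m)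
open import Data.Nat.Divisibility using (divides-refl)
import Data.Nat.ListAction as List
open import Data.Nat.Properties
  using (≤-trans; ≤-reflexive; +-mono-≤; +-assoc; +-identityʳ; +-cancelʳ-≡; <⇒≱; ≤∧≢⇒<; 1+n≰n; n≤0⇒n≡0;
         +-*-semiring; module ≤-Reasoning)
open import Algebra.Properties.Semiring.Sum +-*-semiring using (sum-cong-≗; ∑-distrib-+) renaming (sum to ∑)
import Data.Nat.Properties as ℕ using (_≟_)
open import Data.Nat.Tactic.RingSolver using (solve-∀)
open import Data.Product.Base using (∃; _×_; _,_; proj₁; proj₂)
open import Data.Sum.Base using (_⊎_; inj₁; inj₂; [_,_])
import Data.Sum.Base as Sum
open import Function.Base using (id)
open import Relation.Binary.Construct.Closure.ReflexiveTransitive using (Star; ε; _◅_)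
open import Relation.Binary.PropositionalEquality
  using (_≡_; _≢_; ≢-sym; refl; sym; trans; cong; cong₂; subst; module ≡-Reasoning)
open import Relation.Nullary using (¬_; Dec; yes; no; does; _×-dec_; ¬?; contradiction)
open import Relation.Nullary.Decidable using (decidable-stable)
open import Relation.Unary using (Decidable)

χ : ∀ {A : Set} → Dec A → ℕ
χ d = if does d then 1 else 0

private
  variable
    A B P Q R S : Set

χ-yes : A → (d : Dec A) → χ d ≡ 1
χ-yes _ (yes _) = refl
χ-yes a (no ¬a) = ⊥-elim (¬a a)

χ-no : ¬ A → (d : Dec A) → χ d ≡ 0
χ-no ¬a (yes a) = ⊥-elim (¬a a)
χ-no _ (no _) = refl

χ-mono : (A → B) → (d : Dec A) (e : Dec B) → χ d ≤ χ e
χ-mono _ (no _) _ = z≤n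
χ-mono f (yes a) e = ≤-reflexive (sym (χ-yes (f a) e))

χ-cong : (A → B) → (B → A) → (d : Dec A) (e : Dec B) → χ d ≡ χ e
χ-cong f g (yes a) e = sym (χ-yes (f a) e)
χ-cong f g (no ¬a) e = sym (χ-no (λ b → ¬a (g b)) e)

χ-⊎-× : (dR : Dec R) (dS : Dec S) (dP : Dec P) (dQ : Dec Q) →
  (R → P ⊎ Q) → (P → R) → (Q → R) → (S → P × Q) → (P → Q → S) →
  χ dR + χ dS ≡ χ dP + χ dQ
χ-⊎-× dR dS (yes p) (yes q) _ P→R _ _ PQ→S = cong₂ _+_ (χ-yes (P→R p) dR) (χ-yes (PQ→S p q) dS)
χ-⊎-× dR dS (yes p) (no ¬q) _ P→R _ S→PQ _ =
  cong₂ _+_ (χ-yes (P→R p) dR) (χ-no (λ s → ¬q (proj₂ (S→PQ s))) dS)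
χ-⊎-× dR dS (no ¬p) (yes q) _ _ Q→R S→PQ _ =
  cong₂ _+_ (χ-yes (Q→R q) dR) (χ-no (λ s → ¬p (proj₁ (S→PQ s))) dS)
χ-⊎-× dR dS (no ¬p) (no ¬q) R→PQ _ _ S→PQ _ =
  cong₂ _+_ (χ-no (λ r → [ ¬p , ¬q ] (R→PQ r)) dR) (χ-no (λ s → ¬p (proj₁ (S→PQ s))) dS)

χ-⊎ : (dR : Dec R) (dP : Dec P) (dQ : Dec Q) →
  (R → P ⊎ Q) → (P → R) → (Q → R) → ¬ (P × Q) → χ dR ≡ χ dP + χ dQ
χ-⊎ dR dP dQ R→PQ P→R Q→R disjoint = begin
  χ dR                       ≡⟨ sym (+-identityʳ (χ dR)) ⟩
  χ dR + 0                   ≡⟨ cong (χ dR +_) (sym (χ-no disjoint (dP ×-dec dQ))) ⟩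
  χ dR + χ (dP ×-dec dQ)     ≡⟨ χ-⊎-× dR (dP ×-dec dQ) dP dQ R→PQ P→R Q→R id _,_ ⟩
  χ dP + χ dQ                ∎
  where open ≡-Reasoning

∑-mono : ∀ {n} {f g : Fin n → ℕ} → (∀ i → f i ≤ g i) → ∑ f ≤ ∑ g
∑-mono {zero} _ = z≤n
∑-mono {suc n} f≤g = +-mono-≤ (f≤g zero) (∑-mono (λ i → f≤g (suc i)))

∑-zero : ∀ {n} {f : Fin n → ℕ} → (∀ i → f i ≡ 0) → ∑ f ≡ 0
∑-zero {zero} _ = refl
∑-zero {suc n} f≡0 = cong₂ _+_ (f≡0 zero) (∑-zero (λ i → f≡0 (suc i)))

δ : ∀ {n} → Fin n → ℕ → Fin n → ℕ
δ c k i = if does (i ≟ c) then k else 0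

∑-δ : ∀ {n} (c : Fin n) k → ∑ (δ c k) ≡ k
∑-δ {suc n} zero k = trans (cong (k +_) (∑-zero {n} (λ _ → refl))) (+-identityʳ k)
∑-δ {suc n} (suc c) k = ∑-δ c k

∑-perturb : ∀ {n} {a b : Fin n} → a ≢ b → (f g : Fin n → ℕ) {p q r s : ℕ} →
  f a + p ≡ g a + r → f b + q ≡ g b + s → (∀ i → i ≢ a → i ≢ b → f i ≡ g i) →
  ∑ f + (p + q) ≡ ∑ g + (r + s)
∑-perturb {a = a} {b} a≢b f g {p} {q} {r} {s} at-a at-b elsewhere = begin
  ∑ f + (p + q)                                ≡⟨ spread f p q ⟩
  ∑ (λ i → f i + (δ a p i + δ b q i))          ≡⟨ sum-cong-≗ pointwise ⟩
  ∑ (λ i → g i + (δ a r i + δ b s i))          ≡⟨ sym (spread g r s) ⟩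
  ∑ g + (r + s)                                ∎
  where
  open ≡-Reasoning
  spread : ∀ h x y → ∑ h + (x + y) ≡ ∑ (λ i → h i + (δ a x i + δ b y i))
  spread h x y = begin
    ∑ h + (x + y)                                ≡⟨ cong (∑ h +_) (sym (cong₂ _+_ (∑-δ a x) (∑-δ b y))) ⟩
    ∑ h + (∑ (δ a x) + ∑ (δ b y))                ≡⟨ cong (∑ h +_) (sym (∑-distrib-+ (δ a x) (δ b y))) ⟩
    ∑ h + ∑ (λ i → δ a x i + δ b y i)            ≡⟨ sym (∑-distrib-+ h _) ⟩
    ∑ (λ i → h i + (δ a x i + δ b y i))          ∎
  pointwise : ∀ i → f i + (δ a p i + δ b q i) ≡ g i + (δ a r i + δ b s i)
  pointwise i with i ≟ a | i ≟ b
  ... | yes refl | yes refl = ⊥-elim (a≢b refl)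
  ... | yes refl | no _ = trans (cong (f i +_) (+-identityʳ p)) (trans at-a (cong (g i +_) (sym (+-identityʳ r))))
  ... | no _ | yes refl = at-b
  ... | no i≢a | no i≢b = cong (_+ 0) (elsewhere i i≢a i≢b)

count-sum : ∀ {n} {P : Fin n → Set} (P? : Decidable P) → count P? ≡ ∑ (λ i → χ (P? i))
count-sum {n} P? = go id
  where
  go : ∀ {m} (g : Fin m → Fin n) → length (filter P? (tabulate g)) ≡ ∑ (λ i → χ (P? (g i)))
  go {zero} g = refl
  go {suc m} g with does (P? (g zero))
  ... | true = cong suc (go (λ i → g (suc i)))
  ... | false = go (λ i → g (suc i))

module _ {n : ℕ} where

  open import Data.List.Membership.DecPropositional (_≟_ {n}) using (_∈?_)

  ∑-χ∈ : (xs : List (Fin n)) → Unique xs → ∑ (λ i → χ (i ∈? xs)) ≡ length xs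
  ∑-χ∈ [] _ = ∑-zero {n} (λ _ → refl)
  ∑-χ∈ (x ∷ xs) (x∉xs ∷ uniq) = begin
    ∑ (λ i → χ (i ∈? x ∷ xs))                   ≡⟨ sum-cong-≗ split ⟩
    ∑ (λ i → χ (i ≟ x) + χ (i ∈? xs))           ≡⟨ ∑-distrib-+ (λ i → χ (i ≟ x)) (λ i → χ (i ∈? xs)) ⟩
    ∑ (λ i → χ (i ≟ x)) + ∑ (λ i → χ (i ∈? xs)) ≡⟨ cong₂ _+_ (∑-δ x 1) (∑-χ∈ xs uniq) ⟩
    suc (length xs)                             ∎
    where
    open ≡-Reasoning
    split : ∀ i → χ (i ∈? x ∷ xs) ≡ χ (i ≟ x) + χ (i ∈? xs)
    split i = χ-⊎ (i ∈? x ∷ xs) (i ≟ x) (i ∈? xs)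
      (λ { (here i≡x) → inj₁ i≡x ; (there i∈xs) → inj₂ i∈xs }) here there
      (λ { (refl , i∈xs) → All.All¬⇒¬Any {P = x ≡_} x∉xs i∈xs })

  module _ {P : Fin n → Set} (P? : Decidable P) where

    count-≥ : (xs : List (Fin n)) → Unique xs → All P xs → length xs ≤ count P?
    count-≥ xs uniq all = begin
      length xs                   ≡⟨ ∑-χ∈ xs uniq ⟨
      ∑ (λ i → χ (i ∈? xs))       ≤⟨ ∑-mono (λ i → χ-mono (lookup all) (i ∈? xs) (P? i)) ⟩
      ∑ (λ i → χ (P? i))          ≡⟨ count-sum P? ⟨
      count P?                    ∎
      where open ≤-Reasoning

    count-≤ : (xs : List (Fin n)) → Unique xs → (∀ i → P i → i ∈ xs) → count P? ≤ length xs
    count-≤ xs uniq covered = begin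
      count P?                    ≡⟨ count-sum P? ⟩
      ∑ (λ i → χ (P? i))          ≤⟨ ∑-mono (λ i → χ-mono (covered i) (P? i) (i ∈? xs)) ⟩
      ∑ (λ i → χ (i ∈? xs))       ≡⟨ ∑-χ∈ xs uniq ⟩
      length xs                   ∎
      where open ≤-Reasoning

    count-outside : (xs : List (Fin n)) → Unique xs → length xs < count P? → ∃ λ i → P i × i ∉ xs
    count-outside xs uniq longer with any? (λ i → P? i ×-dec ¬? (i ∈? xs))
    ... | yes found = found
    ... | no none = contradiction (count-≤ xs uniq covered) (<⇒≱ longer)
      where
      covered : ∀ i → P i → i ∈ xs
      covered i p = decidable-stable (i ∈? xs) (λ i∉xs → none (i , p , i∉xs))

    count-none : (∀ i → ¬ P i) → count P? ≡ 0
    count-none none = n≤0⇒n≡0 (count-≤ [] [] (λ i p → contradiction p (none i)))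

    count-unique : count P? ≡ 1 → ∀ {x y} → P x → P y → y ≡ x
    count-unique count≡1 {x} {y} px py = decidable-stable (y ≟ x) λ y≢x →
      <⇒≱ (s≤s (s≤s z≤n)) (≤-trans (count-≥ (x ∷ y ∷ []) ((≢-sym y≢x ∷ []) ∷ [] ∷ []) (px ∷ py ∷ [])) (≤-reflexive count≡1))

    count-witness : 0 < count P? → ∃ P
    count-witness positive with i , p , _ ← count-outside [] [] positive = i , p

    count-another : 1 < count P? → ∀ x → ∃ λ y → P y × y ≢ x
    count-another more x with y , p , y∉ ← count-outside (x ∷ []) ([] ∷ []) more = y , p , λ y≡x → y∉ (here y≡x)

count-cong : ∀ {n} {P Q : Fin n → Set} (P? : Decidable P) (Q? : Decidable Q) →
  (∀ i → P i → Q i) → (∀ i → Q i → P i) → count P? ≡ count Q?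
count-cong P? Q? P⇒Q Q⇒P = begin
  count P?              ≡⟨ count-sum P? ⟩
  ∑ (λ i → χ (P? i))    ≡⟨ sum-cong-≗ (λ i → χ-cong (P⇒Q i) (Q⇒P i) (P? i) (Q? i)) ⟩
  ∑ (λ i → χ (Q? i))    ≡⟨ count-sum Q? ⟨
  count Q?              ∎
  where open ≡-Reasoning

sum-allFin : ∀ {n} (f : Fin n → ℕ) → List.sum (map f (allFin n)) ≡ ∑ f
sum-allFin f = go f id
  where
  go : ∀ {m k} (g : Fin k → ℕ) (h : Fin m → Fin k) → List.sum (map g (tabulate h)) ≡ ∑ (λ i → g (h i))
  go {zero} g h = refl
  go {suc m} g h = cong (g (h zero) +_) (go g (λ i → h (suc i)))

module _ where

  private
    variable
      n : ℕ
      K : Cx n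
      t : Tri n
      a b c u v w : Fin n

  Spans : Fin n → Fin n → Fin n → Tri n → Set
  Spans u v w t = u ∈ᵗ t × v ∈ᵗ t × w ∈ᵗ t

  Distinct : Fin n → Fin n → Fin n → Set
  Distinct u v w = u ≢ v × v ≢ w × u ≢ w

  private
    pigeonhole : ∀ {q r : Fin n} → u ≡ q ⊎ u ≡ r → v ≡ q ⊎ v ≡ r → w ≡ q ⊎ w ≡ r → ¬ Distinct u v w
    pigeonhole (inj₁ refl) (inj₁ refl) _ (u≢v , _ , _) = u≢v refl
    pigeonhole (inj₂ refl) (inj₂ refl) _ (u≢v , _ , _) = u≢v refl
    pigeonhole (inj₁ refl) (inj₂ refl) (inj₁ refl) (_ , _ , u≢w) = u≢w refl
    pigeonhole (inj₁ refl) (inj₂ refl) (inj₂ refl) (_ , v≢w , _) = v≢w refl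
    pigeonhole (inj₂ refl) (inj₁ refl) (inj₁ refl) (_ , v≢w , _) = v≢w refl
    pigeonhole (inj₂ refl) (inj₁ refl) (inj₂ refl) (_ , _ , u≢w) = u≢w refl

    not-first : ∀ {p q r : Fin n} → u ∈ᵗ (p , q , r) → p ≢ u → u ≡ q ⊎ u ≡ r
    not-first (inj₁ u≡p) p≢u = ⊥-elim (p≢u (sym u≡p))
    not-first (inj₂ u∈qr) _ = u∈qr

    first-corner : ∀ {p q r : Fin n} → Spans u v w (p , q , r) → Distinct u v w → p ≡ u ⊎ p ≡ v ⊎ p ≡ w
    first-corner {u = u} {v} {w} {p} (u∈t , v∈t , w∈t) distinct with p ≟ u | p ≟ v | p ≟ w
    ... | yes p≡u | _ | _ = inj₁ p≡u
    ... | no _ | yes p≡v | _ = inj₂ (inj₁ p≡v)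
    ... | no _ | no _ | yes p≡w = inj₂ (inj₂ p≡w)
    ... | no p≢u | no p≢v | no p≢w =
      ⊥-elim (pigeonhole (not-first u∈t p≢u) (not-first v∈t p≢v) (not-first w∈t p≢w) distinct)

    rotate : ∀ {p q r : Fin n} → u ∈ᵗ (p , q , r) → u ∈ᵗ (q , r , p)
    rotate (inj₁ e) = inj₂ (inj₂ e)
    rotate (inj₂ (inj₁ e)) = inj₁ e
    rotate (inj₂ (inj₂ e)) = inj₂ (inj₁ e)

    rotateˢ : ∀ {p q r : Fin n} → Spans u v w (p , q , r) → Spans u v w (q , r , p)
    rotateˢ (u∈t , v∈t , w∈t) = rotate u∈t , rotate v∈t , rotate w∈t

  spanned-corner : Spans u v w t → Distinct u v w → c ∈ᵗ t → c ≡ u ⊎ c ≡ v ⊎ c ≡ w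
  spanned-corner {t = _ , _ , _} spans distinct (inj₁ refl) = first-corner spans distinct
  spanned-corner {t = _ , _ , _} spans distinct (inj₂ (inj₁ refl)) = first-corner (rotateˢ spans) distinct
  spanned-corner {t = _ , _ , _} spans distinct (inj₂ (inj₂ refl)) = first-corner (rotateˢ (rotateˢ spans)) distinct

  spanned-∉ : Spans u v w t → Distinct u v w → c ≢ u → c ≢ v → c ≢ w → ¬ c ∈ᵗ t
  spanned-∉ spans distinct c≢u c≢v c≢w c∈t = [ c≢u , [ c≢v , c≢w ] ] (spanned-corner spans distinct c∈t)

  IsFace-swap : IsFace K u v w → IsFace K v u w
  IsFace-swap ((u≢v , v≢w , u≢w) , spanned) =
    (≢-sym u≢v , u≢w , v≢w) , Any.map (λ { (u∈t , v∈t , w∈t) → v∈t , u∈t , w∈t }) spanned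

  IsFace-rotate : IsFace K u v w → IsFace K v w u
  IsFace-rotate ((u≢v , v≢w , u≢w) , spanned) =
    (v≢w , ≢-sym u≢w , ≢-sym u≢v) , Any.map (λ { (u∈t , v∈t , w∈t) → v∈t , w∈t , u∈t }) spanned

  IsFace-rotate² : IsFace K u v w → IsFace K w u v
  IsFace-rotate² face = IsFace-rotate (IsFace-rotate face)

  IsFace-reflect : IsFace K u v w → IsFace K w v u
  IsFace-reflect face = IsFace-swap (IsFace-rotate face)

  IsFace⇒Edge : IsFace K u v w → Edge K u v
  IsFace⇒Edge {w = w} face = proj₁ (proj₁ face) , w , face

  IsFace⇒Vertex : IsFace K u v w → Vertex K u
  IsFace⇒Vertex (_ , spanned) = Any.map proj₁ spanned

  Edge-sym : Edge K u v → Edge K v u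
  Edge-sym (u≢v , w , face) = ≢-sym u≢v , w , IsFace-swap face

  Edge-irrefl : ¬ Edge K u u
  Edge-irrefl (u≢u , _) = u≢u refl

  Edge⇒Vertex : Edge K u v → Vertex K u
  Edge⇒Vertex (_ , _ , face) = IsFace⇒Vertex face

  Vertex⇒IsFace : All Proper K → Vertex K u → ∃ λ v → ∃ λ w → IsFace K u v w
  Vertex⇒IsFace ((p≢q , q≢r , p≢r) ∷ _) (here (inj₁ refl)) =
    _ , _ , (p≢q , q≢r , p≢r) , here (inj₁ refl , inj₂ (inj₁ refl) , inj₂ (inj₂ refl))
  Vertex⇒IsFace ((p≢q , q≢r , p≢r) ∷ _) (here (inj₂ (inj₁ refl))) =
    _ , _ , (≢-sym p≢q , p≢r , q≢r) , here (inj₂ (inj₁ refl) , inj₁ refl , inj₂ (inj₂ refl))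
  Vertex⇒IsFace ((p≢q , q≢r , p≢r) ∷ _) (here (inj₂ (inj₂ refl))) =
    _ , _ , (≢-sym p≢r , p≢q , ≢-sym q≢r) , here (inj₂ (inj₂ refl) , inj₁ refl , inj₂ (inj₁ refl))
  Vertex⇒IsFace (_ ∷ proper) (there u∈K) with v , w , distinct , spanned ← Vertex⇒IsFace proper u∈K =
    v , w , distinct , there spanned

  Vertex⇒Edge : All Proper K → Vertex K u → ∃ λ v → Edge K u v
  Vertex⇒Edge proper u∈K with v , w , face ← Vertex⇒IsFace proper u∈K = v , IsFace⇒Edge face

  AllPairs-separate : ∀ {A : Set} {R : A → A → Set} {P Q : A → Set} {xs : List A} →
    AllPairs R xs → Any P xs → Any Q xs → (∀ {x} → P x → ¬ Q x) →
    ∃ λ s → ∃ λ t → R s t × (P s × Q t ⊎ Q s × P t)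
  AllPairs-separate (_ ∷ _) (here p) (here q) disjoint = ⊥-elim (disjoint p q)
  AllPairs-separate (Rx ∷ _) (here p) (there q) _ with t , t∈xs , qt ← find q =
    _ , t , lookup Rx t∈xs , inj₁ (p , qt)
  AllPairs-separate (Rx ∷ _) (there p) (here q) _ with t , t∈xs , pt ← find p =
    _ , t , lookup Rx t∈xs , inj₂ (q , pt)
  AllPairs-separate (_ ∷ pairs) (there p) (there q) disjoint = AllPairs-separate pairs p q disjoint

  ⊆⇒SameSet : ∀ (s t : Tri n) → (∀ {c} → c ∈ᵗ s → c ∈ᵗ t) → SameSet s t
  ⊆⇒SameSet (p , q , r) t s⊆t = s⊆t (inj₁ refl) , s⊆t (inj₂ (inj₁ refl)) , s⊆t (inj₂ (inj₂ refl))

  module Contraction {n} (K : Cx n) {a b : Fin n} (a≢b : a ≢ b) where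

    K′ : Cx n
    K′ = contract K a b

    ρ : Fin n → Fin n
    ρ = rename a b

    ρᵗ : Tri n → Tri n
    ρᵗ (p , q , r) = ρ p , ρ q , ρ r

    Survives : Tri n → Set
    Survives t = ¬ (a ∈ᵗ t × b ∈ᵗ t)

    survives? : Decidable Survives
    survives? t = ¬? ((a ∈ᵗ? t) ×-dec (b ∈ᵗ? t))

    ρ-b : ρ b ≡ a
    ρ-b with b ≟ b
    ... | yes _ = refl
    ... | no b≢b = ⊥-elim (b≢b refl)

    ρ-fix : c ≢ b → ρ c ≡ c
    ρ-fix {c} c≢b with c ≟ b
    ... | yes c≡b = ⊥-elim (c≢b c≡b)
    ... | no _ = refl

    ρ≢b : ρ c ≢ b
    ρ≢b {c} with c ≟ b
    ... | yes _ = a≢b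
    ... | no c≢b = c≢b

    ∈-ρᵗ⁻ : u ∈ᵗ ρᵗ t → ∃ λ c → c ∈ᵗ t × u ≡ ρ c
    ∈-ρᵗ⁻ {t = p , q , r} (inj₁ e) = p , inj₁ refl , e
    ∈-ρᵗ⁻ {t = p , q , r} (inj₂ (inj₁ e)) = q , inj₂ (inj₁ refl) , e
    ∈-ρᵗ⁻ {t = p , q , r} (inj₂ (inj₂ e)) = r , inj₂ (inj₂ refl) , e

    ∈-ρᵗ⁺ : c ∈ᵗ t → ρ c ∈ᵗ ρᵗ t
    ∈-ρᵗ⁺ {t = _ , _ , _} (inj₁ refl) = inj₁ refl
    ∈-ρᵗ⁺ {t = _ , _ , _} (inj₂ (inj₁ refl)) = inj₂ (inj₁ refl)
    ∈-ρᵗ⁺ {t = _ , _ , _} (inj₂ (inj₂ refl)) = inj₂ (inj₂ refl)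

    b∉ρᵗ : ∀ t → ¬ b ∈ᵗ ρᵗ t
    b∉ρᵗ t b∈ρt with c , _ , b≡ρc ← ∈-ρᵗ⁻ {t = t} b∈ρt = ρ≢b {c} (sym b≡ρc)

    ∈-ρᵗ-fix : u ∈ᵗ t → u ≢ b → u ∈ᵗ ρᵗ t
    ∈-ρᵗ-fix {t = t} u∈t u≢b = subst (_∈ᵗ ρᵗ t) (ρ-fix u≢b) (∈-ρᵗ⁺ u∈t)

    a∈ρᵗ : b ∈ᵗ t → a ∈ᵗ ρᵗ t
    a∈ρᵗ {t = t} b∈t = subst (_∈ᵗ ρᵗ t) ρ-b (∈-ρᵗ⁺ b∈t)

    ∈-ρᵗ-back : u ≢ a → u ∈ᵗ ρᵗ t → u ∈ᵗ t
    ∈-ρᵗ-back {t = t} u≢a u∈ρt with c , c∈t , refl ← ∈-ρᵗ⁻ u∈ρt with c ≟ b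
    ... | yes refl = ⊥-elim (u≢a refl)
    ... | no _ = c∈t

    a∈ρᵗ⁻ : a ∈ᵗ ρᵗ t → a ∈ᵗ t ⊎ b ∈ᵗ t
    a∈ρᵗ⁻ {t = t} a∈ρt with c , c∈t , a≡ρc ← ∈-ρᵗ⁻ a∈ρt with c ≟ b
    ... | yes refl = inj₂ c∈t
    ... | no _ = inj₁ (subst (_∈ᵗ t) (sym a≡ρc) c∈t)

    any-K′⁻ : ∀ {P : Tri n → Set} → Any P K′ → Any (λ t → Survives t × P (ρᵗ t)) K
    any-K′⁻ p with t′ , t′∈K′ , pt′ ← find p with t , t∈K , refl , survives ← ∈-map∘filter⁻ ρᵗ _ t′∈K′ =
      lose t∈K (survives , pt′)

    any-K′⁺ : ∀ {P : Tri n → Set} → Any (λ t → Survives t × P (ρᵗ t)) K → Any P K′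
    any-K′⁺ p with t , t∈K , survives , pt ← find p = lose (∈-map∘filter⁺ ρᵗ _ (t , t∈K , refl , survives)) pt

    IsFace-K′⇒K : u ≢ a → v ≢ a → w ≢ a → IsFace K′ u v w → IsFace K u v w
    IsFace-K′⇒K u≢a v≢a w≢a (distinct , spanned) = distinct , Any.map
      (λ (_ , u∈ , v∈ , w∈) → ∈-ρᵗ-back u≢a u∈ , ∈-ρᵗ-back v≢a v∈ , ∈-ρᵗ-back w≢a w∈)
      (any-K′⁻ spanned)

    IsFace-K⇒K′ : u ≢ a → v ≢ a → w ≢ a → u ≢ b → v ≢ b → w ≢ b → IsFace K u v w → IsFace K′ u v w
    IsFace-K⇒K′ u≢a v≢a w≢a u≢b v≢b w≢b (distinct , spanned) = distinct , any-K′⁺ (Any.map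
      (λ spans@(u∈ , v∈ , w∈) →
         (λ (a∈ , _) → spanned-∉ spans distinct (≢-sym u≢a) (≢-sym v≢a) (≢-sym w≢a) a∈) ,
         ∈-ρᵗ-fix u∈ u≢b , ∈-ρᵗ-fix v∈ v≢b , ∈-ρᵗ-fix w∈ w≢b)
      spanned)

    IsFace-K′-a⇒K : v ≢ a → w ≢ a → v ≢ b → w ≢ b → IsFace K′ a v w → IsFace K a v w ⊎ IsFace K b v w
    IsFace-K′-a⇒K v≢a w≢a v≢b w≢b (distinct@(a≢v , v≢w , a≢w) , spanned)
      with Any-⊎⁻ (Any.map (λ (_ , a∈ , v∈ , w∈) → merge (a∈ρᵗ⁻ a∈) (∈-ρᵗ-back v≢a v∈) (∈-ρᵗ-back w≢a w∈))
                           (any-K′⁻ spanned))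
      where
      merge : ∀ {t} → a ∈ᵗ t ⊎ b ∈ᵗ t → v ∈ᵗ t → w ∈ᵗ t → Spans a v w t ⊎ Spans b v w t
      merge (inj₁ a∈) v∈ w∈ = inj₁ (a∈ , v∈ , w∈)
      merge (inj₂ b∈) v∈ w∈ = inj₂ (b∈ , v∈ , w∈)
    ... | inj₁ at-a = inj₁ (distinct , at-a)
    ... | inj₂ at-b = inj₂ ((≢-sym v≢b , v≢w , ≢-sym w≢b) , at-b)

    IsFace-K-a⇒K′ : v ≢ a → w ≢ a → v ≢ b → w ≢ b → IsFace K a v w ⊎ IsFace K b v w → IsFace K′ a v w
    IsFace-K-a⇒K′ v≢a w≢a v≢b w≢b (inj₁ (distinct , spanned)) = distinct , any-K′⁺ (Any.map
      (λ spans@(a∈ , v∈ , w∈) →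
         (λ (_ , b∈) → spanned-∉ spans distinct (≢-sym a≢b) (≢-sym v≢b) (≢-sym w≢b) b∈) ,
         ∈-ρᵗ-fix a∈ a≢b , ∈-ρᵗ-fix v∈ v≢b , ∈-ρᵗ-fix w∈ w≢b)
      spanned)
    IsFace-K-a⇒K′ v≢a w≢a v≢b w≢b (inj₂ (distinct@(_ , v≢w , _) , spanned)) =
      (≢-sym v≢a , v≢w , ≢-sym w≢a) , any-K′⁺ (Any.map
      (λ spans@(b∈ , v∈ , w∈) →
         (λ (a∈ , _) → spanned-∉ spans distinct a≢b (≢-sym v≢a) (≢-sym w≢a) a∈) ,
         a∈ρᵗ b∈ , ∈-ρᵗ-fix v∈ v≢b , ∈-ρᵗ-fix w∈ w≢b)
      spanned)

    ¬Vertex-K′-b : ¬ Vertex K′ b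
    ¬Vertex-K′-b b∈K′ = none (any-K′⁻ b∈K′)
      where
      none : ∀ {L : Cx n} → ¬ Any (λ t → Survives t × b ∈ᵗ ρᵗ t) L
      none {L = t ∷ _} (here (_ , b∈)) = b∉ρᵗ t b∈
      none (there p) = none p

    IsFace-K′-≢b : IsFace K′ u v w → u ≢ b
    IsFace-K′-≢b face refl = ¬Vertex-K′-b (IsFace⇒Vertex face)

    module _ {v w : Fin n} (v≢a : v ≢ a) (w≢a : w ≢ a) (v≢b : v ≢ b) (w≢b : w ≢ b) where

      private
        Merged : Tri n → Set
        Merged t = Spans a v w t ⊎ Spans b v w t

        image-spans : Merged t → Spans a v w (ρᵗ t)
        image-spans (inj₁ (a∈ , v∈ , w∈)) = ∈-ρᵗ-fix a∈ a≢b , ∈-ρᵗ-fix v∈ v≢b , ∈-ρᵗ-fix w∈ w≢b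
        image-spans (inj₂ (b∈ , v∈ , w∈)) = a∈ρᵗ b∈ , ∈-ρᵗ-fix v∈ v≢b , ∈-ρᵗ-fix w∈ w≢b

        image-corners : Distinct a v w → Distinct b v w → Merged t → c ∈ᵗ ρᵗ t → c ≡ a ⊎ c ≡ v ⊎ c ≡ w
        image-corners {t = t} distinctᵃ distinctᵇ merged c∈ρt with d , d∈t , refl ← ∈-ρᵗ⁻ {t = t} c∈ρt
          with corner merged d∈t
          where
          corner : Merged t → d ∈ᵗ t → (d ≡ a ⊎ d ≡ b) ⊎ d ≡ v ⊎ d ≡ w
          corner (inj₁ spans) d∈t = Sum.map₁ inj₁ (spanned-corner spans distinctᵃ d∈t)
          corner (inj₂ spans) d∈t = Sum.map₁ inj₂ (spanned-corner spans distinctᵇ d∈t)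
        ... | inj₁ (inj₁ refl) = inj₁ (ρ-fix a≢b)
        ... | inj₁ (inj₂ refl) = inj₁ ρ-b
        ... | inj₂ (inj₁ refl) = inj₂ (inj₁ (ρ-fix v≢b))
        ... | inj₂ (inj₂ refl) = inj₂ (inj₂ (ρ-fix w≢b))

        image-SameSet : Distinct a v w → Distinct b v w → ∀ {s t} → Merged s → Merged t → SameSet (ρᵗ s) (ρᵗ t)
        image-SameSet distinctᵃ distinctᵇ {s} {t} merged-s merged-t =
          ⊆⇒SameSet (ρᵗ s) (ρᵗ t) (λ c∈ρs → into (image-corners distinctᵃ distinctᵇ merged-s c∈ρs))
          where
          into : c ≡ a ⊎ c ≡ v ⊎ c ≡ w → c ∈ᵗ ρᵗ t
          into (inj₁ refl) = proj₁ (image-spans merged-t)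
          into (inj₂ (inj₁ refl)) = proj₁ (proj₂ (image-spans merged-t))
          into (inj₂ (inj₂ refl)) = proj₂ (proj₂ (image-spans merged-t))

        survivesᵃ : Distinct a v w → Spans a v w t → Survives t
        survivesᵃ distinct spans (_ , b∈) = spanned-∉ spans distinct (≢-sym a≢b) (≢-sym v≢b) (≢-sym w≢b) b∈

        survivesᵇ : Distinct b v w → Spans b v w t → Survives t
        survivesᵇ distinct spans (a∈ , _) = spanned-∉ spans distinct a≢b (≢-sym v≢a) (≢-sym w≢a) a∈

        surviving : ∀ {P : Tri n → Set} → (∀ {t} → P t → Survives t) → Any P K → Any P (filter survives? K)
        surviving survives p with t , t∈K , pt ← find p = lose (∈-filter⁺ survives? t∈K (survives pt)) pt

      -- K′ lists no face twice, and faces avw and bvw of K would both become avw.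
      no-double-face : AllPairs (λ s t → ¬ SameSet s t) K′ → IsFace K a v w → ¬ IsFace K b v w
      no-double-face unique (distinctᵃ , at-a) (distinctᵇ , at-b)
        with AllPairs-separate (AllPairs.map⁻ unique)
               (surviving (survivesᵃ distinctᵃ) at-a) (surviving (survivesᵇ distinctᵇ) at-b)
               (λ sᵃ sᵇ → survivesᵃ distinctᵃ sᵃ (proj₁ sᵃ , proj₁ sᵇ))
      ... | _ , _ , s≁t , inj₁ (sᵃ , tᵇ) = s≁t (image-SameSet distinctᵃ distinctᵇ (inj₁ sᵃ) (inj₂ tᵇ))
      ... | _ , _ , s≁t , inj₂ (sᵇ , tᵃ) = s≁t (image-SameSet distinctᵃ distinctᵇ (inj₂ sᵇ) (inj₁ tᵃ))

degree-3⇒boundary : ∀ {n} {K : Cx n} → (∀ v → InnerVertex K v → 4 ≤ deg K v) →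
  ∀ {v} → Vertex K v → deg K v ≡ 3 → BoundaryVertex K v
degree-3⇒boundary {K = K} inner≥4 {v} v∈K deg≡3 =
  decidable-stable (any? (λ u → edge? K v u ×-dec (nFaces K v u ℕ.≟ 1)))
    (λ ¬boundary → 1+n≰n (subst (4 ≤_) deg≡3 (inner≥4 v (v∈K , ¬boundary))))

degrees-summing-to-7 : ∀ {s t} → 3 ≤ s → 3 ≤ t → s + t ≡ 7 → s ≡ 3 ⊎ t ≡ 3
degrees-summing-to-7 {s} {t} 3≤s 3≤t s+t≡7 with s ℕ.≟ 3 | t ℕ.≟ 3
... | yes s≡3 | _ = inj₁ s≡3
... | no _ | yes t≡3 = inj₂ t≡3
... | no s≢3 | no t≢3 =
  contradiction (subst (8 ≤_) s+t≡7 (+-mono-≤ (≤∧≢⇒< 3≤s (≢-sym s≢3)) (≤∧≢⇒< 3≤t (≢-sym t≢3)))) 1+n≰n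

module Contracting {n} {K : Cx n} {a b : Fin n} (a≢b : a ≢ b)
  (triangulation : Triangulation K) (triangulation′ : Triangulation (contract K a b))
  (ab-inner : nFaces K a b ≡ 2) (deg≥3 : ∀ v → Vertex K v → 3 ≤ deg K v) where

  open Contraction K a≢b public

  private
    variable
      u v w : Fin n

  edge-in-1-or-2-faces : Edge K u v → nFaces K u v ≡ 1 ⊎ nFaces K u v ≡ 2
  edge-in-1-or-2-faces = proj₁ (proj₂ (proj₂ triangulation)) _ _

  link-connected : Edge K u v → Edge K u w → Star (IsFace K u) v w
  link-connected = proj₁ (proj₂ (proj₂ (proj₂ triangulation))) _ _ _

  -- The link of u is a path or cycle through a and b; if ua and ub were both boundary edges it would be
  -- the single edge ab, missing the third neighbour of u that the degree bound provides.
  ¬both-boundary : IsFace K a b u → nFaces K u a ≡ 1 → nFaces K u b ≡ 1 → ⊥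
  ¬both-boundary {u} abu one-face-a one-face-b
    with v , uv , v∉ab ← count-outside (edge? K u) (a ∷ b ∷ []) ((a≢b ∷ []) ∷ [] ∷ [])
                           (deg≥3 u (IsFace⇒Vertex (IsFace-rotate² abu))) =
    [ (λ v≡a → v∉ab (here v≡a)) , (λ v≡b → v∉ab (there (here v≡b))) ]
      (walk (link-connected (IsFace⇒Edge uab) uv) (inj₁ refl))
    where
    uab = IsFace-rotate² abu
    uba = IsFace-reflect abu
    walk : ∀ {s t} → Star (IsFace K u) s t → s ≡ a ⊎ s ≡ b → t ≡ a ⊎ t ≡ b
    walk ε s∈ab = s∈ab
    walk (step ◅ steps) (inj₁ refl) = walk steps (inj₂ (count-unique (isFace? K u a) one-face-a uab step))
    walk (step ◅ steps) (inj₂ refl) = walk steps (inj₁ (count-unique (isFace? K u b) one-face-b uba step))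

  third-neighbour : IsFace K a b u → ∃ λ q → q ≢ a × q ≢ b × (IsFace K u a q ⊎ IsFace K u b q)
  third-neighbour {u} abu
    with edge-in-1-or-2-faces (IsFace⇒Edge (IsFace-rotate² abu))
       | edge-in-1-or-2-faces (IsFace⇒Edge (IsFace-reflect abu))
  ... | inj₂ two-faces | _ with q , uaq , q≢b ← count-another (isFace? K u a) (subst (1 <_) (sym two-faces) (s≤s (s≤s z≤n))) b =
    q , ≢-sym (proj₁ (proj₂ (proj₁ uaq))) , q≢b , inj₁ uaq
  ... | inj₁ _ | inj₂ two-faces with q , ubq , q≢a ← count-another (isFace? K u b) (subst (1 <_) (sym two-faces) (s≤s (s≤s z≤n))) a =
    q , q≢a , ≢-sym (proj₁ (proj₂ (proj₁ ubq))) , inj₂ ubq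
  ... | inj₁ one-face-a | inj₁ one-face-b = ⊥-elim (¬both-boundary abu one-face-a one-face-b)

  ¬Edge-K′-b : ¬ Edge K′ u b
  ¬Edge-K′-b (_ , _ , ubw) = IsFace-K′-≢b (IsFace-rotate ubw) refl

  Edge-K′-a⇒K : u ≢ a → u ≢ b → Edge K′ u a → Edge K u a ⊎ Edge K u b
  Edge-K′-a⇒K u≢a u≢b (_ , w , uaw) =
    Sum.map (λ auw → IsFace⇒Edge (IsFace-swap auw)) (λ buw → IsFace⇒Edge (IsFace-swap buw))
      (IsFace-K′-a⇒K u≢a w≢a u≢b w≢b (IsFace-swap uaw))
    where
    w≢a = ≢-sym (proj₁ (proj₂ (proj₁ uaw)))
    w≢b = IsFace-K′-≢b (IsFace-rotate² uaw)

  private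
    Edge-K′-a-from-face : u ≢ a → u ≢ b → IsFace K a b u → Edge K′ u a
    Edge-K′-a-from-face u≢a u≢b abu with q , q≢a , q≢b , uXq ← third-neighbour abu =
      IsFace⇒Edge (IsFace-swap (IsFace-K-a⇒K′ u≢a q≢a u≢b q≢b (Sum.map IsFace-swap IsFace-swap uXq)))

  Edge-K-a⇒K′ : u ≢ a → u ≢ b → Edge K u a ⊎ Edge K u b → Edge K′ u a
  Edge-K-a⇒K′ u≢a u≢b (inj₁ (_ , w , uaw)) with w ≟ b
  ... | yes refl = Edge-K′-a-from-face u≢a u≢b (IsFace-rotate uaw)
  ... | no w≢b = IsFace⇒Edge (IsFace-swap
        (IsFace-K-a⇒K′ u≢a (≢-sym (proj₁ (proj₂ (proj₁ uaw)))) u≢b w≢b (inj₁ (IsFace-swap uaw))))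
  Edge-K-a⇒K′ u≢a u≢b (inj₂ (_ , w , ubw)) with w ≟ a
  ... | yes refl = Edge-K′-a-from-face u≢a u≢b (IsFace-reflect ubw)
  ... | no w≢a = IsFace⇒Edge (IsFace-swap
        (IsFace-K-a⇒K′ u≢a w≢a u≢b (≢-sym (proj₁ (proj₂ (proj₁ ubw)))) (inj₂ (IsFace-swap ubw))))

  Edge-K′⇒K : u ≢ a → u ≢ b → v ≢ a → v ≢ b → Edge K′ u v → Edge K u v
  Edge-K′⇒K u≢a u≢b v≢a v≢b (_ , w , uvw) with w ≟ a
  ... | yes refl = [ (λ auv → IsFace⇒Edge (IsFace-rotate auv)) , (λ buv → IsFace⇒Edge (IsFace-rotate buv)) ]
                     (IsFace-K′-a⇒K u≢a v≢a u≢b v≢b (IsFace-rotate² uvw))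
  ... | no w≢a = IsFace⇒Edge (IsFace-K′⇒K u≢a v≢a w≢a uvw)

  Edge-K⇒K′ : u ≢ a → u ≢ b → v ≢ a → v ≢ b → Edge K u v → Edge K′ u v
  Edge-K⇒K′ u≢a u≢b v≢a v≢b (_ , w , uvw) with w ≟ a | w ≟ b
  ... | yes refl | _ = IsFace⇒Edge (IsFace-rotate
        (IsFace-K-a⇒K′ u≢a v≢a u≢b v≢b (inj₁ (IsFace-rotate² uvw))))
  ... | no _ | yes refl = IsFace⇒Edge (IsFace-rotate
        (IsFace-K-a⇒K′ u≢a v≢a u≢b v≢b (inj₂ (IsFace-rotate² uvw))))
  ... | no w≢a | no w≢b = IsFace⇒Edge (IsFace-K⇒K′ u≢a v≢a w≢a u≢b v≢b w≢b uvw)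

  Common : Fin n → Set
  Common u = Edge K u a × Edge K u b

  common? : Decidable Common
  common? u = edge? K u a ×-dec edge? K u b

  deg-K′-away : u ≢ a → u ≢ b → deg K′ u + χ (common? u) ≡ deg K u
  deg-K′-away {u} u≢a u≢b = +-cancelʳ-≡ (χ (edge? K u b)) _ _ (begin
    deg K′ u + χ (common? u) + χ (edge? K u b)                  ≡⟨ +-assoc (deg K′ u) _ _ ⟩
    deg K′ u + (χ (common? u) + χ (edge? K u b))                ≡⟨ cong (_+ (χ (common? u) + χ (edge? K u b))) (count-sum (edge? K′ u)) ⟩
    ∑ (λ v → χ (edge? K′ u v)) + (χ (common? u) + χ (edge? K u b))
      ≡⟨ ∑-perturb a≢b (λ v → χ (edge? K′ u v)) (λ v → χ (edge? K u v)) at-a at-b elsewhere ⟩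
    ∑ (λ v → χ (edge? K u v)) + (χ (edge? K u b) + 0)           ≡⟨ cong₂ _+_ (sym (count-sum (edge? K u))) (+-identityʳ _) ⟩
    deg K u + χ (edge? K u b)                                   ∎)
    where
    open ≡-Reasoning
    at-a : χ (edge? K′ u a) + χ (common? u) ≡ χ (edge? K u a) + χ (edge? K u b)
    at-a = χ-⊎-× (edge? K′ u a) (common? u) (edge? K u a) (edge? K u b) (Edge-K′-a⇒K u≢a u≢b)
      (λ ua → Edge-K-a⇒K′ u≢a u≢b (inj₁ ua)) (λ ub → Edge-K-a⇒K′ u≢a u≢b (inj₂ ub)) id _,_
    at-b : χ (edge? K′ u b) + χ (edge? K u b) ≡ χ (edge? K u b) + 0
    at-b = trans (cong (_+ _) (χ-no ¬Edge-K′-b (edge? K′ u b))) (sym (+-identityʳ _))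
    elsewhere : ∀ v → v ≢ a → v ≢ b → χ (edge? K′ u v) ≡ χ (edge? K u v)
    elsewhere v v≢a v≢b = χ-cong (Edge-K′⇒K u≢a u≢b v≢a v≢b) (Edge-K⇒K′ u≢a u≢b v≢a v≢b) (edge? K′ u v) (edge? K u v)

  ab-apex : ∃ λ w → IsFace K a b w
  ab-apex = count-witness (isFace? K a b) (subst (0 <_) (sym ab-inner) (s≤s z≤n))

  ab-edge : Edge K a b
  ab-edge = IsFace⇒Edge (proj₂ ab-apex)

  deg-K′-a : deg K′ a + count common? + 2 ≡ deg K a + deg K b
  deg-K′-a = begin
    deg K′ a + count common? + 2
      ≡⟨ cong₂ (λ x y → x + y + 2) (count-sum (edge? K′ a)) (count-sum common?) ⟩
    ∑ (λ v → χ (edge? K′ a v)) + ∑ (λ v → χ (common? v)) + (1 + 1)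
      ≡⟨ cong (_+ 2) (∑-distrib-+ (λ v → χ (edge? K′ a v)) (λ v → χ (common? v))) ⟨
    ∑ (λ v → χ (edge? K′ a v) + χ (common? v)) + (1 + 1)
      ≡⟨ ∑-perturb a≢b (λ v → χ (edge? K′ a v) + χ (common? v)) (λ v → χ (edge? K a v) + χ (edge? K b v)) at-a at-b elsewhere ⟩
    ∑ (λ v → χ (edge? K a v) + χ (edge? K b v)) + (0 + 0)
      ≡⟨ +-identityʳ _ ⟩
    ∑ (λ v → χ (edge? K a v) + χ (edge? K b v))
      ≡⟨ ∑-distrib-+ (λ v → χ (edge? K a v)) (λ v → χ (edge? K b v)) ⟩
    ∑ (λ v → χ (edge? K a v)) + ∑ (λ v → χ (edge? K b v))
      ≡⟨ cong₂ _+_ (count-sum (edge? K a)) (count-sum (edge? K b)) ⟨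
    deg K a + deg K b ∎
    where
    open ≡-Reasoning
    ¬common : ∀ {u} → u ≡ a ⊎ u ≡ b → ¬ Common u
    ¬common (inj₁ refl) (aa , _) = Edge-irrefl aa
    ¬common (inj₂ refl) (_ , bb) = Edge-irrefl bb
    at-a : χ (edge? K′ a a) + χ (common? a) + 1 ≡ χ (edge? K a a) + χ (edge? K b a) + 0
    at-a = trans (cong₂ (λ x y → x + y + 1) (χ-no Edge-irrefl (edge? K′ a a)) (χ-no (¬common (inj₁ refl)) (common? a)))
                 (sym (cong₂ (λ x y → x + y + 0) (χ-no Edge-irrefl (edge? K a a)) (χ-yes (Edge-sym ab-edge) (edge? K b a))))
    at-b : χ (edge? K′ a b) + χ (common? b) + 1 ≡ χ (edge? K a b) + χ (edge? K b b) + 0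
    at-b = trans (cong₂ (λ x y → x + y + 1) (χ-no ¬Edge-K′-b (edge? K′ a b)) (χ-no (¬common (inj₂ refl)) (common? b)))
                 (sym (cong₂ (λ x y → x + y + 0) (χ-yes ab-edge (edge? K a b)) (χ-no Edge-irrefl (edge? K b b))))
    elsewhere : ∀ v → v ≢ a → v ≢ b → χ (edge? K′ a v) + χ (common? v) ≡ χ (edge? K a v) + χ (edge? K b v)
    elsewhere v v≢a v≢b = χ-⊎-× (edge? K′ a v) (common? v) (edge? K a v) (edge? K b v)
      (λ av → Sum.map Edge-sym Edge-sym (Edge-K′-a⇒K v≢a v≢b (Edge-sym av)))
      (λ av → Edge-sym (Edge-K-a⇒K′ v≢a v≢b (inj₁ (Edge-sym av))))
      (λ bv → Edge-sym (Edge-K-a⇒K′ v≢a v≢b (inj₂ (Edge-sym bv))))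
      (λ (va , vb) → Edge-sym va , Edge-sym vb)
      (λ av bv → Edge-sym av , Edge-sym bv)

  deg-K′-b : deg K′ b ≡ 0
  deg-K′-b = count-none (edge? K′ b) (λ v bv → ¬Edge-K′-b (Edge-sym bv))

  deg-sum : ∑ (deg K′) + (count common? + 1) * 2 ≡ ∑ (deg K)
  deg-sum = +-cancelʳ-≡ (deg K b) _ _ (begin
    ∑ (deg K′) + (k + 1) * 2 + deg K b
      ≡⟨ rearrange (∑ (deg K′)) k (deg K b) ⟩
    ∑ (deg K′) + k + (k + 2 + deg K b)
      ≡⟨ cong (λ x → ∑ (deg K′) + x + (k + 2 + deg K b)) (count-sum common?) ⟩
    ∑ (deg K′) + ∑ (λ u → χ (common? u)) + (k + 2 + deg K b)
      ≡⟨ cong (_+ (k + 2 + deg K b)) (∑-distrib-+ (deg K′) (λ u → χ (common? u))) ⟨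
    ∑ (λ u → deg K′ u + χ (common? u)) + (k + 2 + deg K b)
      ≡⟨ ∑-perturb a≢b (λ u → deg K′ u + χ (common? u)) (deg K) at-a at-b (λ _ → deg-K′-away) ⟩
    ∑ (deg K) + (deg K b + 0)
      ≡⟨ cong (∑ (deg K) +_) (+-identityʳ (deg K b)) ⟩
    ∑ (deg K) + deg K b ∎)
    where
    open ≡-Reasoning
    k = count common?
    rearrange : ∀ x y z → x + (y + 1) * 2 + z ≡ x + y + (y + 2 + z)
    rearrange = solve-∀
    at-a : deg K′ a + χ (common? a) + (k + 2) ≡ deg K a + deg K b
    at-a = begin
      deg K′ a + χ (common? a) + (k + 2) ≡⟨ cong (λ x → deg K′ a + x + (k + 2)) (χ-no (λ (aa , _) → Edge-irrefl aa) (common? a)) ⟩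
      deg K′ a + 0 + (k + 2)            ≡⟨ simplify (deg K′ a) k ⟩
      deg K′ a + k + 2                  ≡⟨ deg-K′-a ⟩
      deg K a + deg K b                 ∎
      where
      simplify : ∀ x y → x + 0 + (y + 2) ≡ x + y + 2
      simplify = solve-∀
    at-b : deg K′ b + χ (common? b) + deg K b ≡ deg K b + 0
    at-b = trans (cong₂ (λ x y → x + y + deg K b) deg-K′-b (χ-no (λ (_ , bb) → Edge-irrefl bb) (common? b)))
                 (sym (+-identityʳ (deg K b)))

  Vertex-K′⇒K : u ≢ a → u ≢ b → Vertex K′ u → Vertex K u
  Vertex-K′⇒K u≢a u≢b u∈K′ with v , uv ← Vertex⇒Edge (proj₁ triangulation′) u∈K′ | v ≟ a | v ≟ b
  ... | yes refl | _ = [ Edge⇒Vertex , Edge⇒Vertex ] (Edge-K′-a⇒K u≢a u≢b uv)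
  ... | no _ | yes refl = ⊥-elim (¬Edge-K′-b uv)
  ... | no v≢a | no v≢b = Edge⇒Vertex (Edge-K′⇒K u≢a u≢b v≢a v≢b uv)

  Vertex-K⇒K′ : u ≢ a → u ≢ b → Vertex K u → Vertex K′ u
  Vertex-K⇒K′ u≢a u≢b u∈K with v , uv ← Vertex⇒Edge (proj₁ triangulation) u∈K | v ≟ a | v ≟ b
  ... | yes refl | _ = Edge⇒Vertex (Edge-K-a⇒K′ u≢a u≢b (inj₁ uv))
  ... | no _ | yes refl = Edge⇒Vertex (Edge-K-a⇒K′ u≢a u≢b (inj₂ uv))
  ... | no v≢a | no v≢b = Edge⇒Vertex (Edge-K⇒K′ u≢a u≢b v≢a v≢b uv)

  a∈K′ : Vertex K′ a
  a∈K′ with w , abw ← ab-apex =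
    Edge⇒Vertex (Edge-sym (Edge-K-a⇒K′ (≢-sym (proj₂ (proj₂ (proj₁ abw)))) (≢-sym (proj₁ (proj₂ (proj₁ abw))))
                                        (inj₁ (IsFace⇒Edge (IsFace-rotate² abw)))))

  vertex-count : nV K′ + 1 ≡ nV K
  vertex-count = begin
    nV K′ + 1                              ≡⟨ cong (_+ 1) (count-sum (vertex? K′)) ⟩
    ∑ (λ u → χ (vertex? K′ u)) + (0 + 1)   ≡⟨ ∑-perturb a≢b _ _ at-a at-b elsewhere ⟩
    ∑ (λ u → χ (vertex? K u)) + (0 + 0)    ≡⟨ +-identityʳ _ ⟩
    ∑ (λ u → χ (vertex? K u))              ≡⟨ count-sum (vertex? K) ⟨
    nV K                                   ∎
    where
    open ≡-Reasoning
    at-a : χ (vertex? K′ a) + 0 ≡ χ (vertex? K a) + 0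
    at-a = cong (_+ 0) (trans (χ-yes a∈K′ (vertex? K′ a)) (sym (χ-yes (Edge⇒Vertex ab-edge) (vertex? K a))))
    at-b : χ (vertex? K′ b) + 1 ≡ χ (vertex? K b) + 0
    at-b = trans (cong (_+ 1) (χ-no ¬Vertex-K′-b (vertex? K′ b)))
                 (cong (_+ 0) (sym (χ-yes (Edge⇒Vertex (Edge-sym ab-edge)) (vertex? K b))))
    elsewhere : ∀ u → u ≢ a → u ≢ b → χ (vertex? K′ u) ≡ χ (vertex? K u)
    elsewhere u u≢a u≢b = χ-cong (Vertex-K′⇒K u≢a u≢b) (Vertex-K⇒K′ u≢a u≢b) (vertex? K′ u) (vertex? K u)

  apex : Fin n → ℕ
  apex u = χ (isFace? K a b u)

  private
    no-K′-face-at-b : ∀ {u w} → ¬ IsFace K′ u b w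
    no-K′-face-at-b ubw = IsFace-K′-≢b (IsFace-rotate ubw) refl

    no-double-face′ : ∀ {v w} → v ≢ a → w ≢ a → v ≢ b → w ≢ b → IsFace K a v w → ¬ IsFace K b v w
    no-double-face′ v≢a w≢a v≢b w≢b = no-double-face v≢a w≢a v≢b w≢b (proj₁ (proj₂ triangulation′))

  nFaces-sym : ∀ (L : Cx n) u v → nFaces L u v ≡ nFaces L v u
  nFaces-sym L u v = count-cong (isFace? L u v) (isFace? L v u) (λ _ → IsFace-swap) (λ _ → IsFace-swap)

  nFaces-K′-away : u ≢ a → u ≢ b → v ≢ a → v ≢ b → nFaces K′ u v ≡ nFaces K u v
  nFaces-K′-away {u} {v} u≢a u≢b v≢a v≢b = +-cancelʳ-≡ X _ _ (begin
    nFaces K′ u v + X                          ≡⟨ cong (_+ X) (count-sum (isFace? K′ u v)) ⟩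
    ∑ (λ w → χ (isFace? K′ u v w)) + (0 + X)   ≡⟨ ∑-perturb a≢b _ _ at-a at-b elsewhere ⟩
    ∑ (λ w → χ (isFace? K u v w)) + (X + 0)    ≡⟨ cong₂ _+_ (sym (count-sum (isFace? K u v))) (+-identityʳ X) ⟩
    nFaces K u v + X                           ∎)
    where
    open ≡-Reasoning
    X = χ (isFace? K u v b)
    at-a : χ (isFace? K′ u v a) + 0 ≡ χ (isFace? K u v a) + X
    at-a = trans (+-identityʳ _) (χ-⊎ (isFace? K′ u v a) (isFace? K u v a) (isFace? K u v b)
      (λ uva → Sum.map IsFace-rotate IsFace-rotate (IsFace-K′-a⇒K u≢a v≢a u≢b v≢b (IsFace-rotate² uva)))
      (λ uva → IsFace-rotate (IsFace-K-a⇒K′ u≢a v≢a u≢b v≢b (inj₁ (IsFace-rotate² uva))))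
      (λ uvb → IsFace-rotate (IsFace-K-a⇒K′ u≢a v≢a u≢b v≢b (inj₂ (IsFace-rotate² uvb))))
      (λ (uva , uvb) → no-double-face′ u≢a v≢a u≢b v≢b (IsFace-rotate² uva) (IsFace-rotate² uvb)))
    at-b : χ (isFace? K′ u v b) + X ≡ χ (isFace? K u v b) + 0
    at-b = trans (cong (_+ X) (χ-no (λ uvb → no-K′-face-at-b (IsFace-rotate uvb)) (isFace? K′ u v b))) (sym (+-identityʳ X))
    elsewhere : ∀ w → w ≢ a → w ≢ b → χ (isFace? K′ u v w) ≡ χ (isFace? K u v w)
    elsewhere w w≢a w≢b = χ-cong (IsFace-K′⇒K u≢a v≢a w≢a) (IsFace-K⇒K′ u≢a v≢a w≢a u≢b v≢b w≢b)
      (isFace? K′ u v w) (isFace? K u v w)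

  nFaces-K′-a : u ≢ a → u ≢ b → nFaces K′ u a + (apex u + apex u) ≡ nFaces K u a + nFaces K u b
  nFaces-K′-a {u} u≢a u≢b = begin
    nFaces K′ u a + (apex u + apex u)
      ≡⟨ cong (_+ (apex u + apex u)) (count-sum (isFace? K′ u a)) ⟩
    ∑ (λ w → χ (isFace? K′ u a w)) + (apex u + apex u)
      ≡⟨ ∑-perturb a≢b (λ w → χ (isFace? K′ u a w)) (λ w → χ (isFace? K u a w) + χ (isFace? K u b w)) at-a at-b elsewhere ⟩
    ∑ (λ w → χ (isFace? K u a w) + χ (isFace? K u b w)) + (0 + 0)
      ≡⟨ +-identityʳ _ ⟩
    ∑ (λ w → χ (isFace? K u a w) + χ (isFace? K u b w))
      ≡⟨ ∑-distrib-+ (λ w → χ (isFace? K u a w)) (λ w → χ (isFace? K u b w)) ⟩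
    ∑ (λ w → χ (isFace? K u a w)) + ∑ (λ w → χ (isFace? K u b w))
      ≡⟨ cong₂ _+_ (count-sum (isFace? K u a)) (count-sum (isFace? K u b)) ⟨
    nFaces K u a + nFaces K u b ∎
    where
    open ≡-Reasoning
    ¬repeated : ∀ {x} → ¬ IsFace K u x x
    ¬repeated ((_ , x≢x , _) , _) = x≢x refl
    at-a : χ (isFace? K′ u a a) + apex u ≡ χ (isFace? K u a a) + χ (isFace? K u b a) + 0
    at-a = begin
      χ (isFace? K′ u a a) + apex u   ≡⟨ cong (_+ apex u) (χ-no (λ ((_ , a≢a , _) , _) → a≢a refl) (isFace? K′ u a a)) ⟩
      apex u                          ≡⟨ χ-cong IsFace-reflect IsFace-reflect (isFace? K a b u) (isFace? K u b a) ⟩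
      χ (isFace? K u b a)             ≡⟨ cong₂ (λ x y → x + y) (χ-no ¬repeated (isFace? K u a a)) refl ⟨
      χ (isFace? K u a a) + χ (isFace? K u b a)   ≡⟨ +-identityʳ _ ⟨
      χ (isFace? K u a a) + χ (isFace? K u b a) + 0 ∎
    at-b : χ (isFace? K′ u a b) + apex u ≡ χ (isFace? K u a b) + χ (isFace? K u b b) + 0
    at-b = begin
      χ (isFace? K′ u a b) + apex u   ≡⟨ cong (_+ apex u) (χ-no (λ uab → no-K′-face-at-b (IsFace-rotate uab)) (isFace? K′ u a b)) ⟩
      apex u                          ≡⟨ χ-cong IsFace-rotate² IsFace-rotate (isFace? K a b u) (isFace? K u a b) ⟩
      χ (isFace? K u a b)             ≡⟨ +-identityʳ _ ⟨
      χ (isFace? K u a b) + 0         ≡⟨ cong (χ (isFace? K u a b) +_) (χ-no ¬repeated (isFace? K u b b)) ⟨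
      χ (isFace? K u a b) + χ (isFace? K u b b)   ≡⟨ +-identityʳ _ ⟨
      χ (isFace? K u a b) + χ (isFace? K u b b) + 0 ∎
    elsewhere : ∀ w → w ≢ a → w ≢ b → χ (isFace? K′ u a w) ≡ χ (isFace? K u a w) + χ (isFace? K u b w)
    elsewhere w w≢a w≢b = χ-⊎ (isFace? K′ u a w) (isFace? K u a w) (isFace? K u b w)
      (λ uaw → Sum.map IsFace-swap IsFace-swap (IsFace-K′-a⇒K u≢a w≢a u≢b w≢b (IsFace-swap uaw)))
      (λ uaw → IsFace-swap (IsFace-K-a⇒K′ u≢a w≢a u≢b w≢b (inj₁ (IsFace-swap uaw))))
      (λ ubw → IsFace-swap (IsFace-K-a⇒K′ u≢a w≢a u≢b w≢b (inj₂ (IsFace-swap ubw))))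
      (λ (uaw , ubw) → no-double-face′ u≢a w≢a u≢b w≢b (IsFace-swap uaw) (IsFace-swap ubw))

  incidences : Cx n → Fin n → ℕ
  incidences L u = ∑ (nFaces L u)

  private
    nFaces-K′-b : ∀ u → nFaces K′ b u ≡ 0
    nFaces-K′-b u = count-none (isFace? K′ b u) (λ w buw → no-K′-face-at-b (IsFace-swap buw))

    apex-a : apex a ≡ 0
    apex-a = χ-no (λ ((_ , _ , a≢a) , _) → a≢a refl) (isFace? K a b a)

    apex-b : apex b ≡ 0
    apex-b = χ-no (λ ((_ , b≢b , _) , _) → b≢b refl) (isFace? K a b b)

    ∑-apex : ∑ apex ≡ 2
    ∑-apex = trans (sym (count-sum (isFace? K a b))) ab-inner

  incidences-K′-away : u ≢ a → u ≢ b → incidences K′ u + (apex u + apex u) ≡ incidences K u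
  incidences-K′-away {u} u≢a u≢b = +-cancelʳ-≡ (nFaces K u b) _ _ (begin
    incidences K′ u + (apex u + apex u) + nFaces K u b   ≡⟨ +-assoc (incidences K′ u) _ _ ⟩
    incidences K′ u + (apex u + apex u + nFaces K u b)   ≡⟨ ∑-perturb a≢b (nFaces K′ u) (nFaces K u) at-a at-b elsewhere ⟩
    incidences K u + (nFaces K u b + 0)                  ≡⟨ cong (incidences K u +_) (+-identityʳ _) ⟩
    incidences K u + nFaces K u b                        ∎)
    where
    open ≡-Reasoning
    at-a : nFaces K′ u a + (apex u + apex u) ≡ nFaces K u a + nFaces K u b
    at-a = nFaces-K′-a u≢a u≢b
    at-b : nFaces K′ u b + nFaces K u b ≡ nFaces K u b + 0
    at-b = trans (cong (_+ nFaces K u b) (trans (nFaces-sym K′ u b) (nFaces-K′-b u))) (sym (+-identityʳ _))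
    elsewhere : ∀ v → v ≢ a → v ≢ b → nFaces K′ u v ≡ nFaces K u v
    elsewhere v = nFaces-K′-away u≢a u≢b

  incidences-K′-a : incidences K′ a + 8 ≡ incidences K a + incidences K b
  incidences-K′-a = begin
    incidences K′ a + 8
      ≡⟨ +-assoc (incidences K′ a) 4 4 ⟨
    incidences K′ a + (2 + 2) + (2 + 2)
      ≡⟨ cong (λ x → incidences K′ a + (x + x) + (2 + 2)) ∑-apex ⟨
    incidences K′ a + (∑ apex + ∑ apex) + (2 + 2)
      ≡⟨ cong (λ x → incidences K′ a + x + (2 + 2)) (∑-distrib-+ apex apex) ⟨
    incidences K′ a + ∑ (λ v → apex v + apex v) + (2 + 2)
      ≡⟨ cong (_+ (2 + 2)) (∑-distrib-+ (nFaces K′ a) (λ v → apex v + apex v)) ⟨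
    ∑ (λ v → nFaces K′ a v + (apex v + apex v)) + (2 + 2)
      ≡⟨ ∑-perturb a≢b (λ v → nFaces K′ a v + (apex v + apex v)) (λ v → nFaces K a v + nFaces K b v) at-a at-b elsewhere ⟩
    ∑ (λ v → nFaces K a v + nFaces K b v) + (0 + 0)
      ≡⟨ +-identityʳ _ ⟩
    ∑ (λ v → nFaces K a v + nFaces K b v)
      ≡⟨ ∑-distrib-+ (nFaces K a) (nFaces K b) ⟩
    incidences K a + incidences K b ∎
    where
    open ≡-Reasoning
    no-loops : ∀ L u → nFaces L u u ≡ 0
    no-loops L u = count-none (isFace? L u u) (λ _ ((u≢u , _) , _) → u≢u refl)
    at-a : nFaces K′ a a + (apex a + apex a) + 2 ≡ nFaces K a a + nFaces K b a + 0
    at-a = trans (cong₂ (λ x y → x + (y + y) + 2) (no-loops K′ a) apex-a)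
                 (sym (cong₂ (λ x y → x + y + 0) (no-loops K a) (trans (nFaces-sym K b a) ab-inner)))
    at-b : nFaces K′ a b + (apex b + apex b) + 2 ≡ nFaces K a b + nFaces K b b + 0
    at-b = trans (cong₂ (λ x y → x + (y + y) + 2) (trans (nFaces-sym K′ a b) (nFaces-K′-b a)) apex-b)
                 (sym (cong₂ (λ x y → x + y + 0) ab-inner (no-loops K b)))
    elsewhere : ∀ v → v ≢ a → v ≢ b → nFaces K′ a v + (apex v + apex v) ≡ nFaces K a v + nFaces K b v
    elsewhere v v≢a v≢b = begin
      nFaces K′ a v + (apex v + apex v)  ≡⟨ cong (_+ (apex v + apex v)) (nFaces-sym K′ a v) ⟩
      nFaces K′ v a + (apex v + apex v)  ≡⟨ nFaces-K′-a v≢a v≢b ⟩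
      nFaces K v a + nFaces K v b        ≡⟨ cong₂ _+_ (nFaces-sym K v a) (nFaces-sym K v b) ⟩
      nFaces K a v + nFaces K b v        ∎

  incidence-sum : ∑ (incidences K′) + 12 ≡ ∑ (incidences K)
  incidence-sum = +-cancelʳ-≡ (incidences K b) _ _ (begin
    ∑ (incidences K′) + 12 + incidences K b
      ≡⟨ rearrange (∑ (incidences K′)) (incidences K b) ⟩
    ∑ (incidences K′) + (2 + 2) + (8 + incidences K b)
      ≡⟨ cong (λ x → ∑ (incidences K′) + (x + x) + (8 + incidences K b)) ∑-apex ⟨
    ∑ (incidences K′) + (∑ apex + ∑ apex) + (8 + incidences K b)
      ≡⟨ cong (λ x → ∑ (incidences K′) + x + (8 + incidences K b)) (∑-distrib-+ apex apex) ⟨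
    ∑ (incidences K′) + ∑ (λ u → apex u + apex u) + (8 + incidences K b)
      ≡⟨ cong (_+ (8 + incidences K b)) (∑-distrib-+ (incidences K′) (λ u → apex u + apex u)) ⟨
    ∑ (λ u → incidences K′ u + (apex u + apex u)) + (8 + incidences K b)
      ≡⟨ ∑-perturb a≢b (λ u → incidences K′ u + (apex u + apex u)) (incidences K) at-a at-b elsewhere ⟩
    ∑ (incidences K) + (incidences K b + 0)
      ≡⟨ cong (∑ (incidences K) +_) (+-identityʳ _) ⟩
    ∑ (incidences K) + incidences K b ∎)
    where
    open ≡-Reasoning
    rearrange : ∀ x y → x + 12 + y ≡ x + (2 + 2) + (8 + y)
    rearrange = solve-∀
    at-a : incidences K′ a + (apex a + apex a) + 8 ≡ incidences K a + incidences K b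
    at-a = trans (cong (λ y → incidences K′ a + (y + y) + 8) apex-a)
                 (trans (cong (_+ 8) (+-identityʳ (incidences K′ a))) incidences-K′-a)
    at-b : incidences K′ b + (apex b + apex b) + incidences K b ≡ incidences K b + 0
    at-b = trans (cong₂ (λ x y → x + (y + y) + incidences K b) (∑-zero nFaces-K′-b) apex-b) (sym (+-identityʳ _))
    elsewhere : ∀ u → u ≢ a → u ≢ b → incidences K′ u + (apex u + apex u) ≡ incidences K u
    elsewhere u = incidences-K′-away

  edge-count : nE K ≡ nE K′ + (count common? + 1)
  edge-count = begin
    nE K                                          ≡⟨ cong (_/ 2) (sum-allFin (deg K)) ⟩
    ∑ (deg K) / 2                                 ≡⟨ cong (_/ 2) deg-sum ⟨
    (∑ (deg K′) + (count common? + 1) * 2) / 2    ≡⟨ +-distrib-/-∣ʳ (∑ (deg K′)) (divides-refl (count common? + 1)) ⟩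
    ∑ (deg K′) / 2 + (count common? + 1) * 2 / 2  ≡⟨ cong₂ _+_ (cong (_/ 2) (sym (sum-allFin (deg K′)))) (m*n/n≡m (count common? + 1) 2) ⟩
    nE K′ + (count common? + 1)                   ∎
    where open ≡-Reasoning

  face-count : nF K ≡ nF K′ + 2
  face-count = begin
    nF K                              ≡⟨ cong (_/ 6) (double-sum K) ⟩
    ∑ (incidences K) / 6              ≡⟨ cong (_/ 6) incidence-sum ⟨
    (∑ (incidences K′) + 2 * 6) / 6   ≡⟨ +-distrib-/-∣ʳ (∑ (incidences K′)) (divides-refl 2) ⟩
    ∑ (incidences K′) / 6 + 2         ≡⟨ cong (λ x → x / 6 + 2) (double-sum K′) ⟨
    nF K′ + 2                         ∎
    where
    open ≡-Reasoning
    double-sum : ∀ L → List.sum (map (λ u → List.sum (map (λ v → count (isFace? L u v)) (allFin n))) (allFin n)) ≡ ∑ (incidences L)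
    double-sum L = trans (sum-allFin (λ u → List.sum (map (nFaces L u) (allFin n)))) (sum-cong-≗ (λ u → sum-allFin (nFaces L u)))

  -- Contraction loses one vertex, 1 + #common edges and two faces, so the Euler characteristic forces two common neighbours.
  common-count : SameSurface K K′ → count common? ≡ 2
  common-count (same-euler , _) = sym (ℤ.+-injective (begin
    ℤ.+ 2                                    ≡⟨ identity (ℤ.+ nV K′) (ℤ.+ nE K′) (ℤ.+ nF K′) (ℤ.+ k) ⟩
    ℤ.+ k ℤ.+ (euler-K ℤ.- euler K′)         ≡⟨ cong (λ z → ℤ.+ k ℤ.+ (z ℤ.- euler K′)) (trans (sym expand) same-euler) ⟩
    ℤ.+ k ℤ.+ (euler K′ ℤ.- euler K′)        ≡⟨ cong (λ z → ℤ.+ k ℤ.+ z) (ℤ.+-inverseʳ (euler K′)) ⟩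
    ℤ.+ k ℤ.+ ℤ.+ 0                          ≡⟨ ℤ.+-identityʳ (ℤ.+ k) ⟩
    ℤ.+ k                                    ∎))
    where
    open ≡-Reasoning

    k = count common?
    euler-K = (ℤ.+ (nV K′ + 1) ℤ.- ℤ.+ (nE K′ + (k + 1))) ℤ.+ ℤ.+ (nF K′ + 2)
    expand : euler K ≡ euler-K
    expand = trans (cong₂ (λ V E → (ℤ.+ V ℤ.- ℤ.+ E) ℤ.+ ℤ.+ nF K) (sym vertex-count) edge-count)
                   (cong (λ F → (ℤ.+ (nV K′ + 1) ℤ.- ℤ.+ (nE K′ + (k + 1))) ℤ.+ ℤ.+ F) face-count)
    identity : ∀ V E F C → ℤ.+ 2 ≡ C ℤ.+ ((((V ℤ.+ ℤ.+ 1) ℤ.- (E ℤ.+ (C ℤ.+ ℤ.+ 1))) ℤ.+ (F ℤ.+ ℤ.+ 2)) ℤ.- ((V ℤ.- E) ℤ.+ F))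
    identity = ℤ-Solver.solve-∀

  module Apexes (two-common : count common? ≡ 2) {x y : Fin n}
           (abx : IsFace K a b x) (aby : IsFace K a b y) (x≢y : x ≢ y) where

    private
      apex-common : IsFace K a b u → Common u
      apex-common abu = IsFace⇒Edge (IsFace-rotate² abu) , IsFace⇒Edge (IsFace-reflect abu)

    common⇒x-or-y : Common u → u ≡ x ⊎ u ≡ y
    common⇒x-or-y {u} common-u with u ≟ x | u ≟ y
    ... | yes u≡x | _ = inj₁ u≡x
    ... | no _ | yes u≡y = inj₂ u≡y
    ... | no u≢x | no u≢y = contradiction (subst (3 ≤_) two-common three) λ { (s≤s (s≤s ())) }
      where
      three = count-≥ common? (x ∷ y ∷ u ∷ []) ((x≢y ∷ ≢-sym u≢x ∷ []) ∷ (≢-sym u≢y ∷ []) ∷ [] ∷ [])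
                (apex-common abx ∷ apex-common aby ∷ common-u ∷ [])

    common⇒apex : Common u → IsFace K a b u
    common⇒apex common-u with common⇒x-or-y common-u
    ... | inj₁ refl = abx
    ... | inj₂ refl = aby

    -- If ua or ub is a boundary edge, so is the merged edge ua of K′: an apex u of ab keeps only the outer
    -- of its two faces at a, any other vertex sees at most one of a and b (it would otherwise be an apex).
    boundary-edge-to-a : u ≢ a → u ≢ b → nFaces K u a ≡ 1 ⊎ nFaces K u b ≡ 1 → nFaces K′ u a ≡ 1
    boundary-edge-to-a {u} u≢a u≢b one-face with isFace? K a b u
    ... | yes abu = +-cancelʳ-≡ 2 _ 1 (begin
      nFaces K′ u a + (1 + 1)            ≡⟨ cong (λ z → nFaces K′ u a + (z + z)) (χ-yes abu (isFace? K a b u)) ⟨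
      nFaces K′ u a + (apex u + apex u)  ≡⟨ nFaces-K′-a u≢a u≢b ⟩
      nFaces K u a + nFaces K u b        ≡⟨ one-and-two one-face ⟩
      1 + 2                              ∎)
      where
      open ≡-Reasoning
      uab = IsFace-rotate² abu
      uba = IsFace-reflect abu
      one-and-two : nFaces K u a ≡ 1 ⊎ nFaces K u b ≡ 1 → nFaces K u a + nFaces K u b ≡ 1 + 2
      one-and-two (inj₁ one-a) with edge-in-1-or-2-faces (IsFace⇒Edge uba)
      ... | inj₁ one-b = ⊥-elim (¬both-boundary abu one-a one-b)
      ... | inj₂ two-b = cong₂ _+_ one-a two-b
      one-and-two (inj₂ one-b) with edge-in-1-or-2-faces (IsFace⇒Edge uab)
      ... | inj₁ one-a = ⊥-elim (¬both-boundary abu one-a one-b)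
      ... | inj₂ two-a = cong₂ _+_ two-a one-b
    ... | no ¬abu = trans (sym (+-identityʳ _)) (begin
      nFaces K′ u a + 0                  ≡⟨ cong (λ z → nFaces K′ u a + (z + z)) (χ-no ¬abu (isFace? K a b u)) ⟨
      nFaces K′ u a + (apex u + apex u)  ≡⟨ nFaces-K′-a u≢a u≢b ⟩
      nFaces K u a + nFaces K u b        ≡⟨ one-and-none one-face ⟩
      1                                  ∎)
      where
      open ≡-Reasoning
      edge : ∀ {v} → nFaces K u v ≡ 1 → Edge K u v
      edge one = IsFace⇒Edge (proj₂ (count-witness (isFace? K u _) (subst (0 <_) (sym one) (s≤s z≤n))))
      one-and-none : nFaces K u a ≡ 1 ⊎ nFaces K u b ≡ 1 → nFaces K u a + nFaces K u b ≡ 1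
      one-and-none (inj₁ one-a) = cong₂ _+_ one-a
        (count-none (isFace? K u b) (λ w ubw → ¬abu (common⇒apex (edge one-a , IsFace⇒Edge ubw))))
      one-and-none (inj₂ one-b) = cong₂ _+_
        (count-none (isFace? K u a) (λ w uaw → ¬abu (common⇒apex (IsFace⇒Edge uaw , edge one-b)))) one-b

    private
      boundary-edge : u ≢ v → nFaces K′ u v ≡ 1 → BoundaryEdge K′ u v
      boundary-edge {u} {v} u≢v one =
        (u≢v , count-witness (isFace? K′ u v) (subst (0 <_) (sym one) (s≤s z≤n))) , one

    boundary⇒K′ : u ≢ a → u ≢ b → BoundaryVertex K u → BoundaryVertex K′ u
    boundary⇒K′ {u} u≢a u≢b (v , (u≢v , _) , one) with v ≟ a | v ≟ b
    ... | yes refl | _ = a , boundary-edge u≢a (boundary-edge-to-a u≢a u≢b (inj₁ one))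
    ... | no _ | yes refl = a , boundary-edge u≢a (boundary-edge-to-a u≢a u≢b (inj₂ one))
    ... | no v≢a | no v≢b = v , boundary-edge u≢v (trans (nFaces-K′-away u≢a u≢b v≢a v≢b) one)

    merged-boundary : BoundaryVertex K a ⊎ BoundaryVertex K b → BoundaryVertex K′ a
    merged-boundary (inj₁ (u , (a≢u , _) , one)) =
      u , boundary-edge (≢-sym u≢a) (trans (nFaces-sym K′ a u) (boundary-edge-to-a u≢a u≢b (inj₁ (trans (nFaces-sym K u a) one))))
      where
      u≢a = ≢-sym a≢u
      u≢b : u ≢ b
      u≢b refl = contradiction (trans (sym ab-inner) one) λ ()
    merged-boundary (inj₂ (u , (b≢u , _) , one)) =
      u , boundary-edge (≢-sym u≢a) (trans (nFaces-sym K′ a u) (boundary-edge-to-a u≢a u≢b (inj₂ (trans (nFaces-sym K u b) one))))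
      where
      u≢b = ≢-sym b≢u
      u≢a : u ≢ a
      u≢a refl = contradiction (trans (sym (trans (nFaces-sym K b a) ab-inner)) one) λ ()

    merged-degree : deg K′ a + 4 ≡ deg K a + deg K b
    merged-degree = trans (sym (+-assoc (deg K′ a) 2 2)) (trans (cong (λ c → deg K′ a + c + 2) (sym two-common)) deg-K′-a)

    new-degree-3 : u ≢ a → u ≢ b → deg K′ u ≡ 3 → deg K u ≢ 3 → (u ≡ x ⊎ u ≡ y) × deg K u ≡ 4
    new-degree-3 {u} u≢a u≢b deg′≡3 deg≢3 with common? u
    ... | yes common-u = common⇒x-or-y common-u ,
          trans (sym (deg-K′-away u≢a u≢b)) (cong₂ _+_ deg′≡3 (χ-yes common-u (common? u)))
    ... | no ¬common = ⊥-elim (deg≢3 (trans (sym (deg-K′-away u≢a u≢b)) (cong₂ _+_ deg′≡3 (χ-no ¬common (common? u)))))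

    merged-triode : (∀ v → InnerVertex K v → 4 ≤ deg K v) → deg K′ a ≡ 3 → BoundaryVertex K′ a
    merged-triode inner≥4 deg′≡3 = merged-boundary (Sum.map
      (degree-3⇒boundary inner≥4 a∈K) (degree-3⇒boundary inner≥4 b∈K)
      (degrees-summing-to-7 (deg≥3 a a∈K) (deg≥3 b b∈K) (trans (sym merged-degree) (cong (_+ 4) deg′≡3))))
      where
      a∈K = Edge⇒Vertex ab-edge
      b∈K = Edge⇒Vertex (Edge-sym ab-edge)

    triodes : (∀ v → InnerVertex K v → 4 ≤ deg K v) → BoundaryVertex K x → (deg K y ≡ 4 → BoundaryVertex K y) →
      ∀ v → Vertex K′ v → deg K′ v ≡ 3 → (v ≡ a ⊎ ¬ deg K v ≡ 3) → Triode K′ v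
    triodes inner≥4 _ _ v _ deg′≡3 (inj₁ refl) = merged-triode inner≥4 deg′≡3 , deg′≡3
    triodes inner≥4 x-boundary y-boundary v v∈K′ deg′≡3 (inj₂ deg≢3) with v ≟ a | v ≟ b
    ... | yes refl | _ = merged-triode inner≥4 deg′≡3 , deg′≡3
    ... | no _ | yes refl = ⊥-elim (¬Vertex-K′-b v∈K′)
    ... | no v≢a | no v≢b with new-degree-3 v≢a v≢b deg′≡3 deg≢3
    ...   | inj₁ refl , _ = boundary⇒K′ v≢a v≢b x-boundary , deg′≡3
    ...   | inj₂ refl , deg≡4 = boundary⇒K′ v≢a v≢b (y-boundary deg≡4) , deg′≡3

lemma1 : ∀ {n} (K : Cx n) (a b x y : Fin n) →
    F4 K → InnerEdge K a b → Contractible K a b →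
    IsFace K a b x → IsFace K a b y → x ≢ y →
    BoundaryVertex K x → deg K x ≡ 4 →
    ((BoundaryVertex K y × 4 ≤ deg K y) ⊎ (InnerVertex K y × 5 ≤ deg K y)) →
    TriodeDetecting K a b
lemma1 K a b x y (triangulation@(_ , _ , one-or-two-faces , _) , deg≥3 , inner≥4) (ab@(a≢b , _) , ¬boundary-ab)
       contractible@(_ , triangulation′ , same-surface) abx aby x≢y x-boundary _ y-degree =
  contractible , Apexes.triodes (common-count same-surface) abx aby x≢y inner≥4 x-boundary y-boundary
  where
  ab-inner : nFaces K a b ≡ 2
  ab-inner = [ (λ one → contradiction one ¬boundary-ab) , id ] (one-or-two-faces a b ab)
  open Contracting a≢b triangulation triangulation′ ab-inner deg≥3 using (common-count; module Apexes)
  y-boundary : deg K y ≡ 4 → BoundaryVertex K y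
  y-boundary deg≡4 = [ proj₁ , (λ (_ , 5≤deg) → contradiction (subst (5 ≤_) deg≡4 5≤deg) 1+n≰n) ] y-degree
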